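{- Let $\sigma_{odd}(n)$ denote the sum of the odd positive divisors of $n$ (with $\sigma_{odd}(n)=0$ for $n\le 0$), and $\sigma_{odd}^{*2}(n)=\sum_{a+b=n,\ a,b\ge 0}\sigma_{odd}(a)\sigma_{odd}(b)$. Then for all integers $n\ge 0$, $\sigma_{odd}^{*2}(5n+1)\equiv 0\pmod 5$. -}

module Defs where

open import Data.Nat using (ℕ; zero; suc; _+_; _*_; _∸_; _%_)
open import Data.Nat.Divisibility using (_∣_; _∣?_)
open import Data.Nat.Properties using (_≟_)
open import Data.List using (List; map; filter; upTo)
open import Data.Nat.ListAction using (sum)

open import Relation.Nullary.Decidable using (_×-dec_)
open import Relation.Binary.PropositionalEquality using (_≡_)


range1 : ℕ → List ℕ
range1 n = map suc (upTo n)

σodd : ℕ → ℕ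
σodd n = sum (filter (λ d → (d ∣? n) ×-dec ((d % 2) ≟ 1)) (range1 n))

σodd*2 : ℕ → ℕ
σodd*2 n = sum (map (λ a → σodd a * σodd (n ∸ a)) (upTo (suc n)))

open import Relation.Binary.PropositionalEquality using (refl)
_ : σodd 12 ≡ 4
_ = refl
_ : σodd 0 ≡ 0
_ = refl
-- σodd*2 6 = 2(σ0σ6 + σ1σ5 + σ2σ4) + σ3² = 2(0+6+1)+16 = 30
_ : σodd*2 6 ≡ 30
_ = refl

-- Write T(n) = σodd*2(n) as the sum of oddPart(x)·oddPart(y) over all (a, b, x, y) ≥ 1 with
-- ax + by = n, where oddPart(x) is x for odd x and 0 otherwise.  Liouville's method evaluates such sums: the
-- involution (a, b, x, y) ↦ (b, a, y, x) and the bijection (a, b, x, y) ↦ (a − b, b, x, x + y)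
-- from {b < a} onto {x < y} make the sum of a suitable polynomial weight in x, y, (−1)^x, (−1)^y
-- vanish, which leaves 48·T(n) = Σ_{am = n} W(m) with W(m) = 4(m³ − m) for odd m and 6m³ for
-- even m.  When n ≡ 1 (mod 5) every divisor a is invertible mod 5 with inverse a³ (Fermat), so
-- pairing m with a = n/m cancels the terms m³ − m, and pairing (a, 2j) with (j, 2a) cancels the
-- even terms; hence 5 divides 48·T(n), and so T(n).

module Submission where

open import Data.Nat as ℕ using (ℕ; zero; suc; z≤n; s≤s; _≤_; _<_)
import Data.Nat.Properties as ℕ
open import Data.Integer as ℤ using (ℤ; +_; 0ℤ; 1ℤ; -1ℤ; _+_; _*_; -_; _-_; _^_)
import Data.Integer.Properties as ℤ
open import Data.Integer.Tactic.RingSolver using (solve-∀; solve)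
open import Data.List using (_∷_; []; map; filter; upTo; applyUpTo)
open import Data.List.Properties using (map-applyUpTo)
open import Data.Nat.ListAction using (sum)
open import Data.Nat.Divisibility using (_∣_; _∣?_; divides; >⇒∤)
open import Defs using (σodd; σodd*2)
import Data.Integer.Divisibility.Signed as ℤᵈ
open ℤᵈ using () renaming (_∣_ to _∣ℤ_)
open import Data.Integer.Coprimality using (Coprime; coprime?; coprime-divisor)
open import Relation.Nullary.Decidable using (_×-dec_; from-yes)
open import Relation.Unary using (Decidable)
open import Data.Sum using (_⊎_; inj₁; inj₂)
open import Data.Product using (_×_)
open import Relation.Binary.Definitions using (tri<; tri≈; tri>)
import Data.Nat.Tactic.RingSolver as ℕ-Solver
open import Function using (id; _∘_; _⇔_; Equivalence; mk⇔)
open import Relation.Nullary using (Dec; does; yes; no; ¬_; contradiction)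
open import Data.Bool using (if_then_else_)
open import Relation.Binary.PropositionalEquality hiding ([_])
open import Algebra.Properties.CommutativeSemigroup ℤ.+-commutativeSemigroup using (interchange)
open import Algebra.Properties.CommutativeSemigroup ℤ.*-commutativeSemigroup using (x∙yz≈y∙xz)

𝟙 : ∀ {p} {P : Set p} → Dec P → ℤ
𝟙 P? = if does P? then 1ℤ else 0ℤ

𝟙-yes : ∀ {p} {P : Set p} (P? : Dec P) → P → 𝟙 P? ≡ 1ℤ
𝟙-yes (yes _) _ = refl
𝟙-yes (no ¬p) p = contradiction p ¬p

𝟙-no : ∀ {p} {P : Set p} (P? : Dec P) → ¬ P → 𝟙 P? ≡ 0ℤ
𝟙-no (yes p) ¬p = contradiction p ¬p
𝟙-no (no _)  _  = refl

𝟙-⇔ : ∀ {p q} {P : Set p} {Q : Set q} (P? : Dec P) (Q? : Dec Q) → P ⇔ Q → 𝟙 P? ≡ 𝟙 Q?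
𝟙-⇔ (yes p) Q? P⇔Q = sym (𝟙-yes Q? (Equivalence.to P⇔Q p))
𝟙-⇔ (no ¬p) Q? P⇔Q = sym (𝟙-no Q? (¬p ∘ Equivalence.from P⇔Q))

𝟙-× : ∀ {p q} {P : Set p} {Q : Set q} (P? : Dec P) (Q? : Dec Q) → 𝟙 (P? ×-dec Q?) ≡ 𝟙 P? * 𝟙 Q?
𝟙-× (yes _) (yes _) = refl
𝟙-× (yes _) (no _)  = refl
𝟙-× (no _)  (yes _) = refl
𝟙-× (no _)  (no _)  = refl

[_≡_] : ℕ → ℕ → ℤ
[ m ≡ n ] = 𝟙 (m ℕ.≟ n)

[_<_] : ℕ → ℕ → ℤ
[ m < n ] = 𝟙 (m ℕ.<? n)

[≡]-no : ∀ {m n} → m ≢ n → [ m ≡ n ] ≡ 0ℤ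
[≡]-no {m} {n} = 𝟙-no (m ℕ.≟ n)

[≡]-vanishes : ∀ {m n} → n < m → [ m ≡ n ] ≡ 0ℤ
[≡]-vanishes n<m = [≡]-no (ℕ.>⇒≢ n<m)

[≡]-sym : ∀ m n → [ m ≡ n ] ≡ [ n ≡ m ]
[≡]-sym m n = 𝟙-⇔ (m ℕ.≟ n) (n ℕ.≟ m) (mk⇔ sym sym)

[<]-yes : ∀ {m n} → m < n → [ m < n ] ≡ 1ℤ
[<]-yes {m} {n} = 𝟙-yes (m ℕ.<? n)

[<]-no : ∀ {m n} → ¬ m < n → [ m < n ] ≡ 0ℤ
[<]-no {m} {n} = 𝟙-no (m ℕ.<? n)

[≡]-trichotomy : ∀ m n → [ m ≡ n ] ≡ 1ℤ - [ m < n ] - [ n < m ]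
[≡]-trichotomy m n with ℕ.<-cmp m n
... | tri< m<n m≢n _   rewrite 𝟙-no (m ℕ.≟ n) m≢n | [<]-yes m<n | [<]-no (ℕ.<⇒≯ m<n) = refl
... | tri≈ _ refl _    rewrite 𝟙-yes (m ℕ.≟ m) refl | [<]-no (ℕ.<-irrefl {m} refl) = refl
... | tri> _ m≢n n<m   rewrite 𝟙-no (m ℕ.≟ n) m≢n | [<]-yes n<m | [<]-no (ℕ.<⇒≯ n<m) = refl

∑< : ℕ → (ℕ → ℤ) → ℤ
∑< zero    f = 0ℤ
∑< (suc n) f = f 0 + ∑< n (f ∘ suc)

syntax ∑< n (λ i → e) = ∑[ i < n ] e

∑⁺ : ℕ → (ℕ → ℤ) → ℤ
∑⁺ n f = ∑< n (f ∘ suc)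

syntax ∑⁺ n (λ i → e) = ∑[ 0< i ≤ n ] e

∑-cong : ∀ n {f f′ : ℕ → ℤ} → (∀ i → i < n → f i ≡ f′ i) → ∑< n f ≡ ∑< n f′
∑-cong zero    f≡g = refl
∑-cong (suc n) f≡g = cong₂ _+_ (f≡g 0 (s≤s z≤n)) (∑-cong n λ i i<n → f≡g (suc i) (s≤s i<n))

∑-cong′ : ∀ n {f f′ : ℕ → ℤ} → (∀ i → f i ≡ f′ i) → ∑< n f ≡ ∑< n f′
∑-cong′ n f≡g = ∑-cong n λ i _ → f≡g i

∑-zero : ∀ n {f : ℕ → ℤ} → (∀ i → i < n → f i ≡ 0ℤ) → ∑< n f ≡ 0ℤ
∑-zero zero    f≡0 = refl
∑-zero (suc n) f≡0 = cong₂ _+_ (f≡0 0 (s≤s z≤n)) (∑-zero n λ i i<n → f≡0 (suc i) (s≤s i<n))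

∑-distrib-+ : ∀ n (f g : ℕ → ℤ) → ∑[ i < n ] (f i + g i) ≡ ∑< n f + ∑< n g
∑-distrib-+ zero    f g = refl
∑-distrib-+ (suc n) f g =
  trans (cong (_+_ (f 0 + g 0)) (∑-distrib-+ n (f ∘ suc) (g ∘ suc))) (interchange (f 0) (g 0) _ _)

*-distribˡ-∑ : ∀ n c (f : ℕ → ℤ) → c * ∑< n f ≡ ∑[ i < n ] (c * f i)
*-distribˡ-∑ zero    c f = ℤ.*-zeroʳ c
*-distribˡ-∑ (suc n) c f =
  trans (ℤ.*-distribˡ-+ c (f 0) _) (cong (_+_ (c * f 0)) (*-distribˡ-∑ n c (f ∘ suc)))

∑-split : ∀ m n (f : ℕ → ℤ) → ∑< (m ℕ.+ n) f ≡ ∑< m f + ∑[ j < n ] f (m ℕ.+ j)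
∑-split zero    n f = sym (ℤ.+-identityˡ _)
∑-split (suc m) n f = trans (cong (_+_ (f 0)) (∑-split m n (f ∘ suc))) (sym (ℤ.+-assoc (f 0) _ _))

∑-truncate : ∀ {m n} {f : ℕ → ℤ} → m ≤ n → (∀ i → m ≤ i → f i ≡ 0ℤ) → ∑< n f ≡ ∑< m f
∑-truncate {m} {n} {f} m≤n tail≡0 = begin
  ∑< n f                                       ≡⟨ cong (λ k → ∑< k f) (sym (ℕ.m+[n∸m]≡n m≤n)) ⟩
  ∑< (m ℕ.+ (n ℕ.∸ m)) f                       ≡⟨ ∑-split m (n ℕ.∸ m) f ⟩
  ∑< m f + ∑[ j < n ℕ.∸ m ] f (m ℕ.+ j)        ≡⟨ cong (_+_ (∑< m f)) (∑-zero (n ℕ.∸ m) λ j _ →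
                                                                        tail≡0 (m ℕ.+ j) (ℕ.m≤m+n m j)) ⟩
  ∑< m f + 0ℤ                                  ≡⟨ ℤ.+-identityʳ _ ⟩
  ∑< m f                                       ∎
  where open ≡-Reasoning

∑-comm : ∀ m n (f : ℕ → ℕ → ℤ) → ∑[ i < m ] ∑[ j < n ] f i j ≡ ∑[ j < n ] ∑[ i < m ] f i j
∑-comm zero    n f = sym (∑-zero n λ _ _ → refl)
∑-comm (suc m) n f =
  trans (cong (_+_ (∑< n (f 0))) (∑-comm m n (f ∘ suc))) (sym (∑-distrib-+ n (f 0) _))

∑-indicator : ∀ n k (f : ℕ → ℤ) → ∑[ i < n ] ([ i ≡ k ] * f i) ≡ [ k < n ] * f k
∑-indicator zero    k       f = refl
∑-indicator (suc n) zero    f =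
  trans (cong (_+_ (1ℤ * f 0)) (∑-zero n λ i _ → ℤ.*-zeroˡ (f (suc i)))) (ℤ.+-identityʳ _)
∑-indicator (suc n) (suc k) f = trans (ℤ.+-identityˡ _) (∑-indicator n k (f ∘ suc))

*-distribʳ-∑ : ∀ n (f : ℕ → ℤ) c → ∑< n f * c ≡ ∑[ i < n ] (f i * c)
*-distribʳ-∑ zero    f c = refl
*-distribʳ-∑ (suc n) f c =
  trans (ℤ.*-distribʳ-+ c (f 0) _) (cong (_+_ (f 0 * c)) (*-distribʳ-∑ n (f ∘ suc) c))

∑-*-∑ : ∀ m n (f g : ℕ → ℤ) → ∑< m f * ∑< n g ≡ ∑[ i < m ] ∑[ j < n ] (f i * g j)
∑-*-∑ m n f g = trans (*-distribʳ-∑ m f (∑< n g)) (∑-cong′ m λ i → *-distribˡ-∑ n (f i) g)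

∑-snoc : ∀ k (f : ℕ → ℤ) → ∑< (suc k) f ≡ ∑< k f + f k
∑-snoc k f = begin
  ∑< (suc k) f               ≡⟨ cong (λ n → ∑< n f) (ℕ.+-comm 1 k) ⟩
  ∑< (k ℕ.+ 1) f             ≡⟨ ∑-split k 1 f ⟩
  ∑< k f + (f (k ℕ.+ 0) + 0ℤ) ≡⟨ cong (_+_ (∑< k f)) (trans (ℤ.+-identityʳ _) (cong f (ℕ.+-identityʳ k))) ⟩
  ∑< k f + f k               ∎
  where open ≡-Reasoning

∑⁺-cong : ∀ n {f f′ : ℕ → ℤ} → (∀ i → f i ≡ f′ i) → ∑⁺ n f ≡ ∑⁺ n f′
∑⁺-cong n f≡g = ∑-cong′ n (f≡g ∘ suc)

∑⁺-cong-≤ : ∀ n {f f′ : ℕ → ℤ} → (∀ i → 0 < i → i ≤ n → f i ≡ f′ i) → ∑⁺ n f ≡ ∑⁺ n f′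
∑⁺-cong-≤ n f≡g = ∑-cong n λ i i<n → f≡g (suc i) (s≤s z≤n) i<n

∑⁺-distrib-+ : ∀ n (f g : ℕ → ℤ) → ∑[ 0< i ≤ n ] (f i + g i) ≡ ∑⁺ n f + ∑⁺ n g
∑⁺-distrib-+ n f g = ∑-distrib-+ n (f ∘ suc) (g ∘ suc)

*-distribˡ-∑⁺ : ∀ n c (f : ℕ → ℤ) → c * ∑⁺ n f ≡ ∑[ 0< i ≤ n ] (c * f i)
*-distribˡ-∑⁺ n c f = *-distribˡ-∑ n c (f ∘ suc)

∑⁺-comm : ∀ n (f : ℕ → ℕ → ℤ) → ∑[ 0< i ≤ n ] ∑[ 0< j ≤ n ] f i j ≡ ∑[ 0< j ≤ n ] ∑[ 0< i ≤ n ] f i j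
∑⁺-comm n f = ∑-comm n n λ i j → f (suc i) (suc j)

∑⁺-pick : ∀ n k (f : ℕ → ℤ) → 0 < k → k ≤ n → ∑[ 0< i ≤ n ] ([ i ≡ k ] * f i) ≡ f k
∑⁺-pick n (suc k) f _ k<n =
  trans (∑-indicator n k (f ∘ suc)) (trans (cong (_* f (suc k)) ([<]-yes k<n)) (ℤ.*-identityˡ (f (suc k))))

∑⁺-pick-none : ∀ n k (f : ℕ → ℤ) → n < k → ∑[ 0< i ≤ n ] ([ i ≡ k ] * f i) ≡ 0ℤ
∑⁺-pick-none n (suc k) f (s≤s n≤k) = trans (∑-indicator n k (f ∘ suc)) (cong (_* f (suc k)) ([<]-no (ℕ.≤⇒≯ n≤k)))

∑⁺-shift : ∀ n k (g : ℕ → ℤ) → (∀ i → n < i → g i ≡ 0ℤ) →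
  ∑[ 0< j ≤ n ] g (j ℕ.+ k) ≡ ∑[ 0< i ≤ n ] ([ k < i ] * g i)
∑⁺-shift n k g g-vanishes = sym (begin
  ∑< n shifted                              ≡⟨ ∑-truncate (ℕ.m≤n+m n k) shifted-vanishes ⟨
  ∑< (k ℕ.+ n) shifted                      ≡⟨ ∑-split k n shifted ⟩
  ∑< k shifted + ∑[ j < n ] shifted (k ℕ.+ j) ≡⟨ cong₂ _+_ (∑-zero k below-k) (∑-cong′ n above-k) ⟩
  0ℤ + ∑[ j < n ] g (suc (k ℕ.+ j))         ≡⟨ ℤ.+-identityˡ _ ⟩
  ∑[ j < n ] g (suc (k ℕ.+ j))              ≡⟨ ∑-cong′ n (λ j → cong (g ∘ suc) (ℕ.+-comm k j)) ⟩
  ∑[ j < n ] g (suc j ℕ.+ k)                ∎)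
  where
  open ≡-Reasoning
  shifted : ℕ → ℤ
  shifted i = [ k < suc i ] * g (suc i)
  shifted-vanishes : ∀ i → n ≤ i → shifted i ≡ 0ℤ
  shifted-vanishes i n≤i = trans (cong ([ k < suc i ] *_) (g-vanishes (suc i) (s≤s n≤i))) (ℤ.*-zeroʳ [ k < suc i ])
  below-k : ∀ i → i < k → shifted i ≡ 0ℤ
  below-k i i<k = cong (_* g (suc i)) ([<]-no (ℕ.≤⇒≯ i<k))
  above-k : ∀ j → shifted (k ℕ.+ j) ≡ g (suc (k ℕ.+ j))
  above-k j = trans (cong (_* g (suc (k ℕ.+ j))) ([<]-yes (s≤s (ℕ.m≤m+n k j)))) (ℤ.*-identityˡ (g (suc (k ℕ.+ j))))

∑⁺²-factor : ∀ n c (f : ℕ → ℕ → ℤ) →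
  ∑[ 0< x ≤ n ] ∑[ 0< y ≤ n ] (c * f x y) ≡ c * ∑[ 0< x ≤ n ] ∑[ 0< y ≤ n ] f x y
∑⁺²-factor n c f = sym (trans (*-distribˡ-∑⁺ n c λ x → ∑⁺ n (f x)) (∑⁺-cong n λ x → *-distribˡ-∑⁺ n c (f x)))

Weight : Set
Weight = ℕ → ℕ → ℕ → ℕ → ℤ

∑⁴ : ℕ → Weight → ℤ
∑⁴ n F = ∑[ 0< a ≤ n ] ∑[ 0< b ≤ n ] ∑[ 0< x ≤ n ] ∑[ 0< y ≤ n ] F a b x y

∑⁴-cong : ∀ n {F G : Weight} → (∀ a b x y → F a b x y ≡ G a b x y) → ∑⁴ n F ≡ ∑⁴ n G
∑⁴-cong n F≡G = ∑⁺-cong n λ a → ∑⁺-cong n λ b → ∑⁺-cong n λ x → ∑⁺-cong n λ y → F≡G a b x y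

private
  ∑ʸ : ℕ → Weight → ℕ → ℕ → ℕ → ℤ
  ∑ʸ n F a b x = ∑⁺ n (F a b x)

  ∑ˣʸ : ℕ → Weight → ℕ → ℕ → ℤ
  ∑ˣʸ n F a b = ∑⁺ n (∑ʸ n F a b)

  ∑ᵇˣʸ : ℕ → Weight → ℕ → ℤ
  ∑ᵇˣʸ n F a = ∑⁺ n (∑ˣʸ n F a)

∑⁴-distrib-+ : ∀ n (F G : Weight) → ∑⁴ n (λ a b x y → F a b x y + G a b x y) ≡ ∑⁴ n F + ∑⁴ n G
∑⁴-distrib-+ n F G =
  trans (∑⁺-cong n λ a → trans (∑⁺-cong n λ b → trans (∑⁺-cong n λ x →
           ∑⁺-distrib-+ n (F a b x) (G a b x))
         (∑⁺-distrib-+ n (∑ʸ n F a b) (∑ʸ n G a b)))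
       (∑⁺-distrib-+ n (∑ˣʸ n F a) (∑ˣʸ n G a)))
  (∑⁺-distrib-+ n (∑ᵇˣʸ n F) (∑ᵇˣʸ n G))

*-distribˡ-∑⁴ : ∀ n c (F : Weight) → c * ∑⁴ n F ≡ ∑⁴ n (λ a b x y → c * F a b x y)
*-distribˡ-∑⁴ n c F =
  trans (*-distribˡ-∑⁺ n c (∑ᵇˣʸ n F)) (∑⁺-cong n λ a →
    trans (*-distribˡ-∑⁺ n c (∑ˣʸ n F a)) (∑⁺-cong n λ b →
      trans (*-distribˡ-∑⁺ n c (∑ʸ n F a b)) (∑⁺-cong n λ x → *-distribˡ-∑⁺ n c (F a b x))))

∑⁴-swap : ∀ n (F : Weight) → ∑⁴ n F ≡ ∑⁴ n (λ a b x y → F b a y x)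
∑⁴-swap n F = sym (trans (∑⁺-comm n λ a b → ∑⁺ n λ x → ∑⁺ n λ y → F b a y x)
                         (∑⁺-cong n λ b → ∑⁺-cong n λ a → ∑⁺-comm n λ x y → F b a y x))

∑⁴-reorder : ∀ n (F : Weight) →
  ∑⁴ n F ≡ ∑[ 0< b ≤ n ] ∑[ 0< x ≤ n ] ∑[ 0< a ≤ n ] ∑[ 0< y ≤ n ] F a b x y
∑⁴-reorder n F = trans (∑⁺-comm n λ a b → ∑⁺ n λ x → ∑⁺ n λ y → F a b x y)
                       (∑⁺-cong n λ b → ∑⁺-comm n λ a x → ∑⁺ n λ y → F a b x y)

∑-∑⁴-comm : ∀ m n (F : ℕ → Weight) → ∑[ k < m ] ∑⁴ n (F k) ≡ ∑⁴ n (λ a b x y → ∑[ k < m ] F k a b x y)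
∑-∑⁴-comm m n F =
  trans (∑-comm m n λ k a → ∑ᵇˣʸ n (F k) (suc a)) (∑⁺-cong n λ a →
  trans (∑-comm m n λ k b → ∑ˣʸ n (F k) a (suc b)) (∑⁺-cong n λ b →
  trans (∑-comm m n λ k x → ∑ʸ n (F k) a b (suc x)) (∑⁺-cong n λ x →
        ∑-comm m n λ k y → F k a b x (suc y))))

restrict-ax+by≡ : ℕ → Weight → Weight
restrict-ax+by≡ n F a b x y = [ a ℕ.* x ℕ.+ b ℕ.* y ≡ n ] * F a b x y

∑ax+by≡ : ℕ → Weight → ℤ
∑ax+by≡ n F = ∑⁴ n (restrict-ax+by≡ n F)

∑ax+by-cong : ∀ n {F G : Weight} → (∀ a b x y → F a b x y ≡ G a b x y) → ∑ax+by≡ n F ≡ ∑ax+by≡ n G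
∑ax+by-cong n F≡G = ∑⁴-cong n λ a b x y → cong ([ a ℕ.* x ℕ.+ b ℕ.* y ≡ n ] *_) (F≡G a b x y)

∑ax+by-distrib-+ : ∀ n (F G : Weight) →
  ∑ax+by≡ n (λ a b x y → F a b x y + G a b x y) ≡ ∑ax+by≡ n F + ∑ax+by≡ n G
∑ax+by-distrib-+ n F G =
  trans (∑⁴-cong n λ a b x y → ℤ.*-distribˡ-+ [ a ℕ.* x ℕ.+ b ℕ.* y ≡ n ] (F a b x y) (G a b x y))
        (∑⁴-distrib-+ n (restrict-ax+by≡ n F) (restrict-ax+by≡ n G))

*-distribˡ-∑ax+by : ∀ n c (F : Weight) → c * ∑ax+by≡ n F ≡ ∑ax+by≡ n (λ a b x y → c * F a b x y)
*-distribˡ-∑ax+by n c F =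
  trans (*-distribˡ-∑⁴ n c (restrict-ax+by≡ n F))
        (∑⁴-cong n λ a b x y → x∙yz≈y∙xz c [ a ℕ.* x ℕ.+ b ℕ.* y ≡ n ] (F a b x y))

∑ax+by-swap : ∀ n (F : Weight) → ∑ax+by≡ n F ≡ ∑ax+by≡ n (λ a b x y → F b a y x)
∑ax+by-swap n F = trans (∑⁴-swap n (restrict-ax+by≡ n F)) (∑⁴-cong n λ a b x y →
  cong (λ t → [ t ≡ n ] * F b a y x) (ℕ.+-comm (b ℕ.* y) (a ℕ.* x)))

∑ax+by-shear : ∀ n (F : Weight) →
  ∑ax+by≡ n (λ a b x y → [ b < a ] * F a b x y) ≡
  ∑ax+by≡ n (λ a b x y → [ x < y ] * F (a ℕ.+ b) b x (y ℕ.∸ x))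
∑ax+by-shear n F =
  trans (∑⁴-reorder n (restrict-ax+by≡ n λ a b x y → [ b < a ] * F a b x y))
        (sym (trans (∑⁴-reorder n (restrict-ax+by≡ n λ a b x y → [ x < y ] * F (a ℕ.+ b) b x (y ℕ.∸ x)))
                    (∑⁺-cong-≤ n λ b 0<b _ → ∑⁺-cong-≤ n λ x 0<x _ → fibre b x 0<b 0<x)))
  where
  open ≡-Reasoning
  regroup : ∀ a b x j → a ℕ.* x ℕ.+ b ℕ.* (j ℕ.+ x) ≡ (a ℕ.+ b) ℕ.* x ℕ.+ b ℕ.* j
  regroup = ℕ-Solver.solve-∀
  fibre : ∀ b x → 0 < b → 0 < x →
    ∑[ 0< a ≤ n ] ∑[ 0< y ≤ n ] ([ a ℕ.* x ℕ.+ b ℕ.* y ≡ n ] * ([ x < y ] * F (a ℕ.+ b) b x (y ℕ.∸ x))) ≡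
    ∑[ 0< a ≤ n ] ∑[ 0< y ≤ n ] ([ a ℕ.* x ℕ.+ b ℕ.* y ≡ n ] * ([ b < a ] * F a b x y))
  fibre b@(suc _) x@(suc _) _ _ = begin
    ∑[ 0< a ≤ n ] ∑[ 0< y ≤ n ] (line a y * ([ x < y ] * F (a ℕ.+ b) b x (y ℕ.∸ x)))
      ≡⟨ ∑⁺-cong n shift-y ⟨
    ∑[ 0< a ≤ n ] ∑[ 0< j ≤ n ] (line a (j ℕ.+ x) * F (a ℕ.+ b) b x (j ℕ.+ x ℕ.∸ x))
      ≡⟨ ∑⁺-cong n (λ a → ∑⁺-cong n λ j →
           cong₂ (λ t u → [ t ≡ n ] * F (a ℕ.+ b) b x u) (regroup a b x j) (ℕ.m+n∸n≡m j x)) ⟩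
    ∑[ 0< a ≤ n ] ∑[ 0< j ≤ n ] (line (a ℕ.+ b) j * F (a ℕ.+ b) b x j)
      ≡⟨ ∑⁺-comm n (λ a j → line (a ℕ.+ b) j * F (a ℕ.+ b) b x j) ⟩
    ∑[ 0< j ≤ n ] ∑[ 0< a ≤ n ] (line (a ℕ.+ b) j * F (a ℕ.+ b) b x j)
      ≡⟨ ∑⁺-cong n shift-a ⟩
    ∑[ 0< j ≤ n ] ∑[ 0< a ≤ n ] (line a j * ([ b < a ] * F a b x j))
      ≡⟨ ∑⁺-comm n (λ a j → line a j * ([ b < a ] * F a b x j)) ⟨
    ∑[ 0< a ≤ n ] ∑[ 0< y ≤ n ] (line a y * ([ b < a ] * F a b x y)) ∎
    where
    line : ℕ → ℕ → ℤ
    line a y = [ a ℕ.* x ℕ.+ b ℕ.* y ≡ n ]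
    shift-y : ∀ a → ∑[ 0< j ≤ n ] (line a (j ℕ.+ x) * F (a ℕ.+ b) b x (j ℕ.+ x ℕ.∸ x)) ≡
                    ∑[ 0< y ≤ n ] (line a y * ([ x < y ] * F (a ℕ.+ b) b x (y ℕ.∸ x)))
    shift-y a =
      trans (∑⁺-shift n x (λ y → line a y * F (a ℕ.+ b) b x (y ℕ.∸ x)) λ y n<y →
               cong (_* F (a ℕ.+ b) b x (y ℕ.∸ x))
                    ([≡]-vanishes (ℕ.<-≤-trans n<y (ℕ.≤-trans (ℕ.m≤n*m y b) (ℕ.m≤n+m (b ℕ.* y) (a ℕ.* x))))))
            (∑⁺-cong n λ y → x∙yz≈y∙xz [ x < y ] (line a y) (F (a ℕ.+ b) b x (y ℕ.∸ x)))
    shift-a : ∀ j → ∑[ 0< a ≤ n ] (line (a ℕ.+ b) j * F (a ℕ.+ b) b x j) ≡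
                    ∑[ 0< a ≤ n ] (line a j * ([ b < a ] * F a b x j))
    shift-a j =
      trans (∑⁺-shift n b (λ a → line a j * F a b x j) λ a n<a →
               cong (_* F a b x j)
                    ([≡]-vanishes (ℕ.<-≤-trans n<a (ℕ.≤-trans (ℕ.m≤m*n a x) (ℕ.m≤m+n (a ℕ.* x) (b ℕ.* j))))))
            (∑⁺-cong n λ a → x∙yz≈y∙xz [ b < a ] (line a j) (F a b x j))

∑ax+by-cancel : ∀ n (F F′ : Weight) → ∑ax+by≡ n F ≡ ∑ax+by≡ n F′ →
  ∑ax+by≡ n (λ a b x y → F a b x y - F′ a b x y) ≡ 0ℤ
∑ax+by-cancel n F F′ ∑F≡∑F′ = begin
  ∑ax+by≡ n (λ a b x y → F a b x y - F′ a b x y)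
    ≡⟨ ∑ax+by-cong n (λ a b x y → cong (_+_ (F a b x y)) (ℤ.-1*i≡-i (F′ a b x y))) ⟨
  ∑ax+by≡ n (λ a b x y → F a b x y + -1ℤ * F′ a b x y)
    ≡⟨ ∑ax+by-distrib-+ n F (λ a b x y → -1ℤ * F′ a b x y) ⟩
  ∑ax+by≡ n F + ∑ax+by≡ n (λ a b x y → -1ℤ * F′ a b x y)
    ≡⟨ cong₂ _+_ (sym ∑F≡∑F′) (*-distribˡ-∑ax+by n -1ℤ F′) ⟨
  ∑ax+by≡ n F′ + -1ℤ * ∑ax+by≡ n F′
    ≡⟨ cong (_+_ (∑ax+by≡ n F′)) (ℤ.-1*i≡-i (∑ax+by≡ n F′)) ⟩
  ∑ax+by≡ n F′ - ∑ax+by≡ n F′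
    ≡⟨ ℤ.+-inverseʳ (∑ax+by≡ n F′) ⟩
  0ℤ ∎
  where open ≡-Reasoning

sgn : ℕ → ℤ
sgn n = -1ℤ ^ n

IsSign : ℤ → Set
IsSign s = s ≡ 1ℤ ⊎ s ≡ -1ℤ

sgn-isSign : ∀ n → IsSign (sgn n)
sgn-isSign zero = inj₁ refl
sgn-isSign (suc n) with sgn-isSign n
... | inj₁ s≡1  = inj₂ (cong (-1ℤ *_) s≡1)
... | inj₂ s≡-1 = inj₁ (cong (-1ℤ *_) s≡-1)

sgn-+ : ∀ m n → sgn (m ℕ.+ n) ≡ sgn m * sgn n
sgn-+ = ℤ.^-distribˡ-+-* -1ℤ

parity : ℕ → ℤ
parity zero          = 0ℤ
parity (suc zero)    = 1ℤ
parity (suc (suc n)) = parity n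

sgn≡1-2parity : ∀ n → sgn n ≡ 1ℤ - + 2 * parity n
sgn≡1-2parity zero          = refl
sgn≡1-2parity (suc zero)    = refl
sgn≡1-2parity (suc (suc n)) = trans (sym (ℤ.*-assoc -1ℤ -1ℤ (sgn n))) (trans (ℤ.*-identityˡ (sgn n)) (sgn≡1-2parity n))

oddPart : ℕ → ℤ
oddPart x = parity x * + x

-- The polynomials are INLINE so that the ring solver, which treats defined functions as opaque
-- constants, sees through them.  Identities that use s² = 1 are checked for s = 1 and s = -1.
module Polynomial where

  -- The weight of Liouville's method: its symmetrisation H satisfies key and diagonal below,
  -- which is all the identity needs.
  G : ℤ → ℤ → ℤ → ℤ → ℤ
  G X Y sX sY = - (+ 2 * (Y * Y)) - X * Y + + 2 * sY * (X * Y + X * X) - sX * sY * (X * Y)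
  {-# INLINE G #-}

  H : ℤ → ℤ → ℤ → ℤ → ℤ
  H X Y sX sY = G X Y sX sY + G Y X sY sX
  {-# INLINE H #-}

  O : ℤ → ℤ → ℤ
  O X s = X * (1ℤ - s)
  {-# INLINE O #-}

  key : ∀ sX sZ → IsSign sX → IsSign sZ → ∀ X Z →
    + 4 * (O X sX * O (X + Z) (sX * sZ)) ≡ H X Z sX sZ - H X (X + Z) sX (sX * sZ)
  key _ _ (inj₁ refl) (inj₁ refl) = solve-∀
  key _ _ (inj₁ refl) (inj₂ refl) = solve-∀
  key _ _ (inj₂ refl) (inj₁ refl) = solve-∀
  key _ _ (inj₂ refl) (inj₂ refl) = solve-∀

  diagonal : ∀ s → IsSign s → ∀ X → G X X s s + + 2 * (O X s * O X s) ≡ 0ℤ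
  diagonal _ (inj₁ refl) = solve-∀
  diagonal _ (inj₂ refl) = solve-∀

  O-parity : ∀ X p → O X (1ℤ - + 2 * p) ≡ + 2 * (p * X)
  O-parity = solve-∀

  Gline : ℤ → ℤ → ℤ → ℤ → ℤ
  Gline M X sM sX =
    - (+ 2 * (M * M)) + + 3 * (M * X) - X * X - sM * (M * X) + sM * (X * X) + + 2 * sM * M * (sX * X)
  {-# INLINE Gline #-}

  along-line : ∀ sX → IsSign sX → ∀ X Y sY → G X Y sX sY ≡ Gline (X + Y) X (sX * sY) sX
  along-line _ (inj₁ refl) = solve-∀
  along-line _ (inj₂ refl) = solve-∀

  -- From the sums of 1, x, x² and (-1)^x x over 1 ≤ x ≤ K; sK stands for (-1)^K.
  GlineSum : ℤ → ℤ → ℤ → ℤ → ℤ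
  GlineSum M sM K sK =
    - (+ 12 * (M * M) * K + + 3 * (sM * M - + 3 * M) * (K * (K + 1ℤ))
       + (1ℤ - sM) * (K * (K + 1ℤ) * (+ 2 * K + 1ℤ)) - + 3 * sM * M * (sK * (+ 2 * K + 1ℤ) - 1ℤ))
  {-# INLINE GlineSum #-}

  GlineSum-zero : ∀ M sM → GlineSum M sM 0ℤ 1ℤ ≡ 0ℤ
  GlineSum-zero = solve-∀

  GlineSum-step : ∀ M sM K sK →
    GlineSum M sM K sK + + 6 * Gline M (1ℤ + K) sM (-1ℤ * sK) ≡ GlineSum M sM (1ℤ + K) (-1ℤ * sK)
  GlineSum-step = solve-∀

  W : ℤ → ℤ → ℤ
  W M s = + 5 * (M * M * M) - + 2 * M + s * (M * M * M + + 2 * M)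
  {-# INLINE W #-}

  GlineSum-W : ∀ sK → IsSign sK → ∀ K → GlineSum (1ℤ + K) (-1ℤ * sK) K sK ≡ - W (1ℤ + K) (-1ℤ * sK)
  GlineSum-W _ (inj₁ refl) = solve-∀
  GlineSum-W _ (inj₂ refl) = solve-∀

g : ℕ → ℕ → ℤ
g x y = Polynomial.G (+ x) (+ y) (sgn x) (sgn y)

h : ℕ → ℕ → ℤ
h x y = g x y + g y x

o : ℕ → ℤ
o x = Polynomial.O (+ x) (sgn x)

u : ℕ → ℕ → ℤ
u x y = o x * o y

u-key : ∀ x z → + 4 * u x (x ℕ.+ z) ≡ h x z - h x (x ℕ.+ z)
u-key x z =
  subst₂ (λ X s → + 4 * (o x * Polynomial.O X s) ≡ h x z - Polynomial.H (+ x) X (sgn x) s)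
         (sym (ℤ.pos-+ x z)) (sym (sgn-+ x z))
         (Polynomial.key (sgn x) (sgn z) (sgn-isSign x) (sgn-isSign z) (+ x) (+ z))

u-diagonal : ∀ x → g x x + + 2 * u x x ≡ 0ℤ
u-diagonal x = Polynomial.diagonal (sgn x) (sgn-isSign x) (+ x)

u≡4oddPart : ∀ x y → u x y ≡ + 4 * (oddPart x * oddPart y)
u≡4oddPart x y = trans (cong₂ _*_ (o≡2oddPart x) (o≡2oddPart y)) (regroup (oddPart x) (oddPart y))
  where
  o≡2oddPart : ∀ x → o x ≡ + 2 * oddPart x
  o≡2oddPart x = trans (cong (Polynomial.O (+ x)) (sgn≡1-2parity x)) (Polynomial.O-parity (+ x) (parity x))
  regroup : ∀ P Q → + 2 * P * (+ 2 * Q) ≡ + 4 * (P * Q)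
  regroup = solve-∀

xy-balance : ∀ x y →
  + 2 * u x y ≡ + 2 * ([ y < x ] - [ x < y ]) * u x y + [ x < y ] * (h x (y ℕ.∸ x) - g y x) + ([ y < x ] - 1ℤ) * g x y
xy-balance x y with ℕ.<-cmp x y
... | tri< x<y _ _ rewrite [<]-yes x<y | [<]-no (ℕ.<⇒≯ x<y) =
  below-diagonal (u x y) (h x (y ℕ.∸ x)) (g x y) (g y x)
    (subst (λ t → + 4 * u x t ≡ h x (y ℕ.∸ x) - h x t) (ℕ.m+[n∸m]≡n (ℕ.<⇒≤ x<y)) (u-key x (y ℕ.∸ x)))
  where
  below-diagonal : ∀ U H′ Gxy Gyx → + 4 * U ≡ H′ - (Gxy + Gyx) →
    + 2 * U ≡ + 2 * (0ℤ - 1ℤ) * U + 1ℤ * (H′ - Gyx) + (0ℤ - 1ℤ) * Gxy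
  below-diagonal U H′ Gxy Gyx 4U≡ = begin
    + 2 * U                                        ≡⟨ solve (U ∷ []) ⟩
    + 4 * U - + 2 * U                              ≡⟨ cong (_- + 2 * U) 4U≡ ⟩
    H′ - (Gxy + Gyx) - + 2 * U                     ≡⟨ solve (U ∷ H′ ∷ Gxy ∷ Gyx ∷ []) ⟩
    + 2 * (0ℤ - 1ℤ) * U + 1ℤ * (H′ - Gyx) + (0ℤ - 1ℤ) * Gxy ∎
    where open ≡-Reasoning
... | tri≈ _ refl _ rewrite [<]-no (ℕ.<-irrefl {x} refl) =
  on-diagonal (u x x) (h x (x ℕ.∸ x)) (g x x) (u-diagonal x)
  where
  on-diagonal : ∀ U H′ G → G + + 2 * U ≡ 0ℤ →
    + 2 * U ≡ + 2 * (0ℤ - 0ℤ) * U + 0ℤ * (H′ - G) + (0ℤ - 1ℤ) * G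
  on-diagonal U H′ G G+2U≡0 = begin
    + 2 * U                                        ≡⟨ solve (U ∷ G ∷ []) ⟩
    (G + + 2 * U) - G                              ≡⟨ cong (_- G) G+2U≡0 ⟩
    0ℤ - G                                         ≡⟨ solve (U ∷ H′ ∷ G ∷ []) ⟩
    + 2 * (0ℤ - 0ℤ) * U + 0ℤ * (H′ - G) + (0ℤ - 1ℤ) * G ∎
    where open ≡-Reasoning
... | tri> _ _ y<x rewrite [<]-yes y<x | [<]-no (ℕ.<⇒≯ y<x) =
  above-diagonal (u x y) (h x (y ℕ.∸ x)) (g x y) (g y x)
  where
  above-diagonal : ∀ U H′ Gxy Gyx →
    + 2 * U ≡ + 2 * (1ℤ - 0ℤ) * U + 0ℤ * (H′ - Gyx) + (1ℤ - 1ℤ) * Gxy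
  above-diagonal = solve-∀

swap-part : Weight
swap-part a b x y = + 2 * [ y < x ] * u x y + [ b < a ] * g y x - [ x < y ] * g y x

liouville-integrand : ∀ a b x y →
  + 2 * u x y + [ a ≡ b ] * g x y ≡
  (swap-part a b x y - swap-part b a y x) + ([ x < y ] * h x (y ℕ.∸ x) - [ b < a ] * h x y)
liouville-integrand a b x y = begin
  + 2 * u x y + [ a ≡ b ] * g x y
    ≡⟨ cong₂ (λ t e → t + e * g x y) (xy-balance x y) ([≡]-trichotomy a b) ⟩
  + 2 * ([ y < x ] - [ x < y ]) * u x y + [ x < y ] * (h x (y ℕ.∸ x) - g y x) + ([ y < x ] - 1ℤ) * g x y
    + (1ℤ - [ a < b ] - [ b < a ]) * g x y
    ≡⟨ rearrange [ a < b ] [ b < a ] [ x < y ] [ y < x ] (u x y) (h x (y ℕ.∸ x)) (g x y) (g y x) ⟩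
  (+ 2 * [ y < x ] * u x y + [ b < a ] * g y x - [ x < y ] * g y x
    - (+ 2 * [ x < y ] * u x y + [ a < b ] * g x y - [ y < x ] * g x y))
    + ([ x < y ] * h x (y ℕ.∸ x) - [ b < a ] * h x y)
    ≡⟨ cong (λ t → (swap-part a b x y - (+ 2 * [ x < y ] * t + [ a < b ] * g x y - [ y < x ] * g x y))
                   + ([ x < y ] * h x (y ℕ.∸ x) - [ b < a ] * h x y))
            (ℤ.*-comm (o x) (o y)) ⟩
  (swap-part a b x y - swap-part b a y x) + ([ x < y ] * h x (y ℕ.∸ x) - [ b < a ] * h x y) ∎
  where
  open ≡-Reasoning
  rearrange : ∀ lab lba lxy lyx U H′ Gxy Gyx →
    + 2 * (lyx - lxy) * U + lxy * (H′ - Gyx) + (lyx - 1ℤ) * Gxy + (1ℤ - lab - lba) * Gxy ≡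
    (+ 2 * lyx * U + lba * Gyx - lxy * Gyx - (+ 2 * lxy * U + lab * Gxy - lyx * Gxy))
      + (lxy * H′ - lba * (Gxy + Gyx))
  rearrange = solve-∀

liouville-identity : ∀ n → ∑ax+by≡ n (λ a b x y → + 2 * u x y + [ a ≡ b ] * g x y) ≡ 0ℤ
liouville-identity n = begin
  ∑ax+by≡ n (λ a b x y → + 2 * u x y + [ a ≡ b ] * g x y)
    ≡⟨ ∑ax+by-cong n liouville-integrand ⟩
  ∑ax+by≡ n (λ a b x y → swap-odd a b x y + shear-odd a b x y)
    ≡⟨ ∑ax+by-distrib-+ n swap-odd shear-odd ⟩
  ∑ax+by≡ n swap-odd + ∑ax+by≡ n shear-odd
    ≡⟨ cong₂ _+_ (∑ax+by-cancel n swap-part (λ a b x y → swap-part b a y x) (∑ax+by-swap n swap-part))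
                 (∑ax+by-cancel n (λ a b x y → [ x < y ] * h x (y ℕ.∸ x)) (λ a b x y → [ b < a ] * h x y)
                                 (sym (∑ax+by-shear n λ a b x y → h x y))) ⟩
  0ℤ ∎
  where
  open ≡-Reasoning
  swap-odd shear-odd : Weight
  swap-odd a b x y = swap-part a b x y - swap-part b a y x
  shear-odd a b x y = [ x < y ] * h x (y ℕ.∸ x) - [ b < a ] * h x y

∑pairs : (ℕ → ℕ → ℕ) → ℕ → (ℕ → ℕ → ℤ) → ℤ
∑pairs c n f = ∑[ 0< a ≤ n ] ∑[ 0< b ≤ n ] ([ c a b ≡ n ] * f a b)

∑pairs-cong : ∀ c n {f f′ : ℕ → ℕ → ℤ} → (∀ a b → 0 < b → f a b ≡ f′ a b) → ∑pairs c n f ≡ ∑pairs c n f′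
∑pairs-cong c n f≡f′ = ∑⁺-cong n λ a → ∑⁺-cong-≤ n λ b 0<b _ → cong ([ c a b ≡ n ] *_) (f≡f′ a b 0<b)

*-distribˡ-∑pairs : ∀ c n x (f : ℕ → ℕ → ℤ) → x * ∑pairs c n f ≡ ∑pairs c n (λ a b → x * f a b)
*-distribˡ-∑pairs c n x f = trans (sym (∑⁺²-factor n x λ a b → [ c a b ≡ n ] * f a b))
  (∑⁺-cong n λ a → ∑⁺-cong n λ b → x∙yz≈y∙xz x [ c a b ≡ n ] (f a b))

∑pairs-distrib-+ : ∀ c n (f g : ℕ → ℕ → ℤ) → ∑pairs c n (λ a b → f a b + g a b) ≡ ∑pairs c n f + ∑pairs c n g
∑pairs-distrib-+ c n f g =
  trans (∑⁺-cong n λ a → trans (∑⁺-cong n λ b → ℤ.*-distribˡ-+ [ c a b ≡ n ] (f a b) (g a b))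
                               (∑⁺-distrib-+ n (λ b → [ c a b ≡ n ] * f a b) (λ b → [ c a b ≡ n ] * g a b)))
        (∑⁺-distrib-+ n (λ a → ∑[ 0< b ≤ n ] ([ c a b ≡ n ] * f a b)) (λ a → ∑[ 0< b ≤ n ] ([ c a b ≡ n ] * g a b)))

∑pairs-symmetrize : ∀ c n (f : ℕ → ℕ → ℤ) → (∀ a b → c a b ≡ c b a) →
  + 2 * ∑pairs c n f ≡ ∑pairs c n (λ a b → f a b + f b a)
∑pairs-symmetrize c n f c-comm = begin
  + 2 * ∑pairs c n f                        ≡⟨ double (∑pairs c n f) ⟩
  ∑pairs c n f + ∑pairs c n f                ≡⟨ cong (_+_ (∑pairs c n f)) swap ⟩
  ∑pairs c n f + ∑pairs c n (λ a b → f b a)  ≡⟨ ∑pairs-distrib-+ c n f (λ a b → f b a) ⟨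
  ∑pairs c n (λ a b → f a b + f b a)         ∎
  where
  open ≡-Reasoning
  double : ∀ X → + 2 * X ≡ X + X
  double = solve-∀
  swap : ∑pairs c n f ≡ ∑pairs c n (λ a b → f b a)
  swap = trans (∑⁺-comm n λ a b → [ c a b ≡ n ] * f a b)
               (∑⁺-cong n λ b → ∑⁺-cong n λ a → cong (λ t → [ t ≡ n ] * f a b) (c-comm a b))

∑pairs-∣ : ∀ {d} c n (f : ℕ → ℕ → ℤ) → (∀ a b → c a b ≡ n → d ∣ℤ f a b) → d ∣ℤ ∑pairs c n f
∑pairs-∣ c n f d∣f = ∑⁺-∣ n λ a → ∑⁺-∣ n λ b → [≡]*-∣ (c a b) n (d∣f a b)
  where
  ∑⁺-∣ : ∀ {d} n {g : ℕ → ℤ} → (∀ i → d ∣ℤ g i) → d ∣ℤ ∑⁺ n g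
  ∑⁺-∣ zero    d∣g = ℤᵈ.divides 0ℤ refl
  ∑⁺-∣ (suc n) d∣g = ℤᵈ.∣m∣n⇒∣m+n (d∣g 1) (∑⁺-∣ n (d∣g ∘ suc))
  [≡]*-∣ : ∀ {d z} p q → (p ≡ q → d ∣ℤ z) → d ∣ℤ [ p ≡ q ] * z
  [≡]*-∣ {d} {z} p q d∣z with p ℕ.≟ q
  ... | yes p≡q = ℤᵈ.∣n⇒∣m*n [ p ≡ q ] (d∣z p≡q)
  ... | no p≢q  = subst (λ t → d ∣ℤ t * z) (sym ([≡]-no p≢q)) (ℤᵈ.divides 0ℤ refl)

∑am≡ : ℕ → (ℕ → ℕ → ℤ) → ℤ
∑am≡ = ∑pairs ℕ._*_

∑⁺-even : ∀ k (f : ℕ → ℤ) → ∑[ 0< m ≤ k ℕ.+ k ] ((1ℤ - parity m) * f m) ≡ ∑[ 0< j ≤ k ] f (j ℕ.+ j)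
∑⁺-even zero    f = refl
∑⁺-even (suc k) f = begin
  0ℤ + ∑< (k ℕ.+ suc k) (λ i → (1ℤ - parity i) * f (suc (suc i)))
    ≡⟨ ℤ.+-identityˡ _ ⟩
  ∑< (k ℕ.+ suc k) (λ i → (1ℤ - parity i) * f (suc (suc i)))
    ≡⟨ cong (λ t → ∑< t (λ i → (1ℤ - parity i) * f (suc (suc i)))) (ℕ.+-suc k k) ⟩
  1ℤ * f 2 + ∑[ 0< m ≤ k ℕ.+ k ] ((1ℤ - parity m) * f (suc (suc m)))
    ≡⟨ cong₂ _+_ (ℤ.*-identityˡ (f 2)) (∑⁺-even k (f ∘ suc ∘ suc)) ⟩
  f 2 + ∑[ 0< j ≤ k ] f (suc (suc (j ℕ.+ j)))
    ≡⟨ cong (_+_ (f 2)) (∑-cong′ k λ j → cong (f ∘ suc) (sym (ℕ.+-suc (suc j) (suc j)))) ⟩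
  ∑[ 0< j ≤ suc k ] f (j ℕ.+ j) ∎
  where open ≡-Reasoning

∑am-even : ∀ n (f : ℕ → ℤ) →
  ∑am≡ n (λ a m → (1ℤ - parity m) * f m) ≡ ∑pairs (λ a j → a ℕ.* (j ℕ.+ j)) n (λ a j → f (j ℕ.+ j))
∑am-even n f = ∑⁺-cong-≤ n λ a 0<a _ → begin
  ∑[ 0< m ≤ n ] ([ a ℕ.* m ≡ n ] * ((1ℤ - parity m) * f m))
    ≡⟨ ∑⁺-cong n (λ m → x∙yz≈y∙xz [ a ℕ.* m ≡ n ] (1ℤ - parity m) (f m)) ⟩
  ∑[ 0< m ≤ n ] ((1ℤ - parity m) * ([ a ℕ.* m ≡ n ] * f m))
    ≡⟨ ∑-truncate (ℕ.m≤m+n n n) (beyond a 0<a) ⟨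
  ∑[ 0< m ≤ n ℕ.+ n ] ((1ℤ - parity m) * ([ a ℕ.* m ≡ n ] * f m))
    ≡⟨ ∑⁺-even n (λ m → [ a ℕ.* m ≡ n ] * f m) ⟩
  ∑[ 0< j ≤ n ] ([ a ℕ.* (j ℕ.+ j) ≡ n ] * f (j ℕ.+ j)) ∎
  where
  open ≡-Reasoning
  beyond : ∀ a → 0 < a → ∀ i → n ≤ i → (1ℤ - parity (suc i)) * ([ a ℕ.* suc i ≡ n ] * f (suc i)) ≡ 0ℤ
  beyond a 0<a i n≤i =
    trans (cong (λ t → (1ℤ - parity (suc i)) * (t * f (suc i)))
                ([≡]-vanishes (ℕ.<-≤-trans (s≤s n≤i) (ℕ.m≤n*m (suc i) a {{ℕ.>-nonZero 0<a}}))))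
          (ℤ.*-zeroʳ (1ℤ - parity (suc i)))

∑x+y≡ : ℕ → (ℕ → ℕ → ℤ) → ℤ
∑x+y≡ m f = ∑[ 0< x ≤ ℕ.pred m ] f x (m ℕ.∸ x)

∑⁺²-antidiagonal : ∀ n k (f : ℕ → ℕ → ℤ) → suc k ≤ n →
  ∑[ 0< x ≤ n ] ∑[ 0< y ≤ n ] ([ x ℕ.+ y ≡ suc k ] * f x y) ≡ ∑x+y≡ (suc k) f
∑⁺²-antidiagonal n k f m≤n = begin
  ∑[ 0< x ≤ n ] ∑[ 0< y ≤ n ] ([ x ℕ.+ y ≡ m ] * f x y)  ≡⟨ ∑⁺-cong n row ⟩
  ∑[ 0< x ≤ n ] ([ x < m ] * f x (m ℕ.∸ x))            ≡⟨ ∑-truncate (ℕ.<⇒≤ m≤n) beyond-m ⟩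
  ∑[ 0< x ≤ k ] ([ x < m ] * f x (m ℕ.∸ x))            ≡⟨ ∑-cong k below-m ⟩
  ∑x+y≡ m f                                              ∎
  where
  open ≡-Reasoning
  m : ℕ
  m = suc k
  row : ∀ x → ∑[ 0< y ≤ n ] ([ x ℕ.+ y ≡ m ] * f x y) ≡ [ x < m ] * f x (m ℕ.∸ x)
  row x with x ℕ.<? m
  ... | yes x<m = begin
    ∑[ 0< y ≤ n ] ([ x ℕ.+ y ≡ m ] * f x y)
      ≡⟨ ∑⁺-cong n (λ y → cong (_* f x y) (𝟙-⇔ (x ℕ.+ y ℕ.≟ m) (y ℕ.≟ m ℕ.∸ x) x+y≡m⇔y≡m∸x)) ⟩
    ∑[ 0< y ≤ n ] ([ y ≡ m ℕ.∸ x ] * f x y)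
      ≡⟨ ∑⁺-pick n (m ℕ.∸ x) (f x) (ℕ.m<n⇒0<n∸m x<m) (ℕ.≤-trans (ℕ.m∸n≤m m x) m≤n) ⟩
    f x (m ℕ.∸ x)                             ≡⟨ ℤ.*-identityˡ (f x (m ℕ.∸ x)) ⟨
    1ℤ * f x (m ℕ.∸ x)                        ≡⟨ cong (_* f x (m ℕ.∸ x)) ([<]-yes x<m) ⟨
    [ x < m ] * f x (m ℕ.∸ x)                 ∎
    where
    x+y≡m⇔y≡m∸x : ∀ {y} → x ℕ.+ y ≡ m ⇔ y ≡ m ℕ.∸ x
    x+y≡m⇔y≡m∸x {y} = mk⇔ (λ e → trans (sym (ℕ.m+n∸m≡n x y)) (cong (ℕ._∸ x) e))
                          (λ e → trans (cong (x ℕ.+_) e) (ℕ.m+[n∸m]≡n (ℕ.<⇒≤ x<m)))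
  ... | no x≮m = trans
    (∑-zero n λ y _ → cong (_* f x (suc y)) ([≡]-vanishes (ℕ.≤-<-trans (ℕ.≮⇒≥ x≮m) (ℕ.m<m+n x (s≤s z≤n)))))
    (sym (cong (_* f x (m ℕ.∸ x)) ([<]-no x≮m)))
  beyond-m : ∀ i → k ≤ i → [ suc i < m ] * f (suc i) (m ℕ.∸ suc i) ≡ 0ℤ
  beyond-m i k≤i = cong (_* f (suc i) (m ℕ.∸ suc i)) ([<]-no (ℕ.≤⇒≯ (s≤s k≤i)))
  below-m : ∀ i → i < k → [ suc i < m ] * f (suc i) (m ℕ.∸ suc i) ≡ f (suc i) (m ℕ.∸ suc i)
  below-m i i<k = trans (cong (_* f (suc i) (m ℕ.∸ suc i)) ([<]-yes (s≤s i<k))) (ℤ.*-identityˡ (f (suc i) (m ℕ.∸ suc i)))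

∑ax+by-diagonal : ∀ n (F : ℕ → ℕ → ℤ) →
  ∑ax+by≡ n (λ a b x y → [ a ≡ b ] * F x y) ≡ ∑am≡ n (λ a m → ∑x+y≡ m F)
∑ax+by-diagonal n F = ∑⁺-cong-≤ n λ a 0<a a≤n → begin
  ∑[ 0< b ≤ n ] ∑[ 0< x ≤ n ] ∑[ 0< y ≤ n ] (line a b x y * ([ a ≡ b ] * F x y))
    ≡⟨ ∑⁺-cong n (factor-[b≡a] a) ⟩
  ∑[ 0< b ≤ n ] ([ b ≡ a ] * ∑[ 0< x ≤ n ] ∑[ 0< y ≤ n ] (line a b x y * F x y))
    ≡⟨ ∑⁺-pick n a (λ b → ∑[ 0< x ≤ n ] ∑[ 0< y ≤ n ] (line a b x y * F x y)) 0<a a≤n ⟩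
  ∑[ 0< x ≤ n ] ∑[ 0< y ≤ n ] (line a a x y * F x y)
    ≡⟨ ∑⁺-cong-≤ n (λ x 0<x _ → ∑⁺-cong n λ y → introduce-m a x y 0<a 0<x) ⟩
  ∑[ 0< x ≤ n ] ∑[ 0< y ≤ n ] ∑[ 0< m ≤ n ] term a x y m
    ≡⟨ trans (∑⁺-cong n λ x → ∑⁺-comm n (term a x)) (∑⁺-comm n λ x m → ∑⁺ n λ y → term a x y m) ⟩
  ∑[ 0< m ≤ n ] ∑[ 0< x ≤ n ] ∑[ 0< y ≤ n ] term a x y m
    ≡⟨ ∑⁺-cong n (factor-[am≡n] a) ⟩
  ∑[ 0< m ≤ n ] ([ a ℕ.* m ≡ n ] * ∑[ 0< x ≤ n ] ∑[ 0< y ≤ n ] ([ x ℕ.+ y ≡ m ] * F x y))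
    ≡⟨ ∑⁺-cong-≤ n (antidiagonal a) ⟩
  ∑[ 0< m ≤ n ] ([ a ℕ.* m ≡ n ] * ∑x+y≡ m F) ∎
  where
  open ≡-Reasoning
  line : ℕ → ℕ → ℕ → ℕ → ℤ
  line a b x y = [ a ℕ.* x ℕ.+ b ℕ.* y ≡ n ]
  term : ℕ → ℕ → ℕ → ℕ → ℤ
  term a x y m = [ m ≡ x ℕ.+ y ] * ([ a ℕ.* m ≡ n ] * F x y)
  factor-[b≡a] : ∀ a b →
    ∑[ 0< x ≤ n ] ∑[ 0< y ≤ n ] (line a b x y * ([ a ≡ b ] * F x y)) ≡
    [ b ≡ a ] * ∑[ 0< x ≤ n ] ∑[ 0< y ≤ n ] (line a b x y * F x y)
  factor-[b≡a] a b = trans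
    (∑⁺-cong n λ x → ∑⁺-cong n λ y →
       trans (x∙yz≈y∙xz (line a b x y) [ a ≡ b ] (F x y)) (cong (_* (line a b x y * F x y)) ([≡]-sym a b)))
    (∑⁺²-factor n [ b ≡ a ] λ x y → line a b x y * F x y)
  factor-[am≡n] : ∀ a m →
    ∑[ 0< x ≤ n ] ∑[ 0< y ≤ n ] term a x y m ≡
    [ a ℕ.* m ≡ n ] * ∑[ 0< x ≤ n ] ∑[ 0< y ≤ n ] ([ x ℕ.+ y ≡ m ] * F x y)
  factor-[am≡n] a m = trans
    (∑⁺-cong n λ x → ∑⁺-cong n λ y →
       trans (x∙yz≈y∙xz [ m ≡ x ℕ.+ y ] [ a ℕ.* m ≡ n ] (F x y))
             (cong (λ t → [ a ℕ.* m ≡ n ] * (t * F x y)) ([≡]-sym m (x ℕ.+ y))))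
    (∑⁺²-factor n [ a ℕ.* m ≡ n ] λ x y → [ x ℕ.+ y ≡ m ] * F x y)
  antidiagonal : ∀ a m → 0 < m → m ≤ n →
    [ a ℕ.* m ≡ n ] * ∑[ 0< x ≤ n ] ∑[ 0< y ≤ n ] ([ x ℕ.+ y ≡ m ] * F x y) ≡ [ a ℕ.* m ≡ n ] * ∑x+y≡ m F
  antidiagonal a (suc k) _ m≤n = cong ([ a ℕ.* suc k ≡ n ] *_) (∑⁺²-antidiagonal n k F m≤n)
  introduce-m : ∀ a x y → 0 < a → 0 < x → line a a x y * F x y ≡ ∑[ 0< m ≤ n ] term a x y m
  introduce-m a x y 0<a 0<x with x ℕ.+ y ℕ.≤? n
  ... | yes x+y≤n = sym (trans
    (∑⁺-pick n (x ℕ.+ y) (λ m → [ a ℕ.* m ≡ n ] * F x y) (ℕ.<-≤-trans 0<x (ℕ.m≤m+n x y)) x+y≤n)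
    (cong (λ t → [ t ≡ n ] * F x y) (ℕ.*-distribˡ-+ a x y)))
  ... | no x+y≰n = trans
    (cong (_* F x y) ([≡]-vanishes (ℕ.<-≤-trans (ℕ.≰⇒> x+y≰n) x+y≤ax+ay)))
    (sym (∑⁺-pick-none n (x ℕ.+ y) (λ m → [ a ℕ.* m ≡ n ] * F x y) (ℕ.≰⇒> x+y≰n)))
    where
    x+y≤ax+ay : x ℕ.+ y ≤ a ℕ.* x ℕ.+ a ℕ.* y
    x+y≤ax+ay = ℕ.≤-trans (ℕ.m≤n*m (x ℕ.+ y) a {{ℕ.>-nonZero 0<a}}) (ℕ.≤-reflexive (ℕ.*-distribˡ-+ a x y))

W : ℕ → ℤ
W m = Polynomial.W (+ m) (sgn m)

∑⁺-Gline : ∀ M sM k → + 6 * ∑[ 0< x ≤ k ] Polynomial.Gline M (+ x) sM (sgn x) ≡ Polynomial.GlineSum M sM (+ k) (sgn k)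
∑⁺-Gline M sM zero = sym (Polynomial.GlineSum-zero M sM)
∑⁺-Gline M sM (suc k) = begin
  + 6 * ∑⁺ (suc k) f                                       ≡⟨ cong (+ 6 *_) (∑-snoc k (f ∘ suc)) ⟩
  + 6 * (∑⁺ k f + f (suc k))                               ≡⟨ ℤ.*-distribˡ-+ (+ 6) (∑⁺ k f) (f (suc k)) ⟩
  + 6 * ∑⁺ k f + + 6 * f (suc k)                           ≡⟨ cong₂ _+_ (∑⁺-Gline M sM k)
                                                                        (cong (λ X → + 6 * Gline M X sM (sgn (suc k))) (ℤ.pos-+ 1 k)) ⟩
  GlineSum M sM (+ k) (sgn k) + + 6 * Gline M (1ℤ + + k) sM (-1ℤ * sgn k)
                                                           ≡⟨ Polynomial.GlineSum-step M sM (+ k) (sgn k) ⟩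
  GlineSum M sM (1ℤ + + k) (sgn (suc k))                   ≡⟨ cong (λ K → GlineSum M sM K (sgn (suc k))) (ℤ.pos-+ 1 k) ⟨
  GlineSum M sM (+ suc k) (sgn (suc k))                    ∎
  where
  open ≡-Reasoning
  open Polynomial using (Gline; GlineSum)
  f : ℕ → ℤ
  f x = Gline M (+ x) sM (sgn x)

∑x+y-g : ∀ k → + 6 * ∑x+y≡ (suc k) g ≡ - W (suc k)
∑x+y-g k = begin
  + 6 * ∑[ 0< x ≤ k ] g x (m ℕ.∸ x)                               ≡⟨ cong (+ 6 *_) (∑⁺-cong-≤ k on-line) ⟩
  + 6 * ∑[ 0< x ≤ k ] Polynomial.Gline (+ m) (+ x) (sgn m) (sgn x) ≡⟨ ∑⁺-Gline (+ m) (sgn m) k ⟩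
  Polynomial.GlineSum (+ m) (sgn m) (+ k) (sgn k)
                                       ≡⟨ cong (λ M → Polynomial.GlineSum M (sgn m) (+ k) (sgn k)) (ℤ.pos-+ 1 k) ⟩
  Polynomial.GlineSum (1ℤ + + k) (-1ℤ * sgn k) (+ k) (sgn k)      ≡⟨ Polynomial.GlineSum-W (sgn k) (sgn-isSign k) (+ k) ⟩
  - Polynomial.W (1ℤ + + k) (sgn m)                               ≡⟨ cong (λ M → - Polynomial.W M (sgn m)) (ℤ.pos-+ 1 k) ⟨
  - W m                                                           ∎
  where
  open ≡-Reasoning
  m : ℕ
  m = suc k
  on-line : ∀ x → 0 < x → x ≤ k → g x (m ℕ.∸ x) ≡ Polynomial.Gline (+ m) (+ x) (sgn m) (sgn x)
  on-line x _ x≤k =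
    trans (Polynomial.along-line (sgn x) (sgn-isSign x) (+ x) (+ (m ℕ.∸ x)) (sgn (m ℕ.∸ x)))
          (cong₂ (λ M s → Polynomial.Gline M (+ x) s (sgn x))
                 (trans (sym (ℤ.pos-+ x (m ℕ.∸ x))) (cong +_ x+[m∸x]≡m))
                 (trans (sym (sgn-+ x (m ℕ.∸ x))) (cong sgn x+[m∸x]≡m)))
    where
    x+[m∸x]≡m : x ℕ.+ (m ℕ.∸ x) ≡ m
    x+[m∸x]≡m = ℕ.m+[n∸m]≡n (ℕ.m≤n⇒m≤1+n x≤k)

48∑ax+by-oddPart≡∑am-W : ∀ n → + 48 * ∑ax+by≡ n (λ a b x y → oddPart x * oddPart y) ≡ ∑am≡ n (λ a m → W m)
48∑ax+by-oddPart≡∑am-W n = begin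
  + 48 * T                                      ≡⟨ rearrange T D ⟩
  + 6 * (+ 8 * T + D) + - + 6 * D               ≡⟨ cong (λ t → + 6 * t + - + 6 * D) 8T+D≡0 ⟩
  + 6 * 0ℤ + - + 6 * D                          ≡⟨ ℤ.+-identityˡ (- + 6 * D) ⟩
  - + 6 * D                                     ≡⟨ cong (- + 6 *_) (∑ax+by-diagonal n g) ⟩
  - + 6 * ∑am≡ n (λ a m → ∑x+y≡ m g)            ≡⟨ *-distribˡ-∑pairs ℕ._*_ n (- + 6) (λ a m → ∑x+y≡ m g) ⟩
  ∑am≡ n (λ a m → - + 6 * ∑x+y≡ m g)            ≡⟨ ∑pairs-cong ℕ._*_ n -6∑x+y-g ⟩
  ∑am≡ n (λ a m → W m)                          ∎
  where
  open ≡-Reasoning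
  T D : ℤ
  T = ∑ax+by≡ n (λ a b x y → oddPart x * oddPart y)
  D = ∑ax+by≡ n (λ a b x y → [ a ≡ b ] * g x y)
  rearrange : ∀ T D → + 48 * T ≡ + 6 * (+ 8 * T + D) + - + 6 * D
  rearrange = solve-∀
  8T+D≡0 : + 8 * T + D ≡ 0ℤ
  8T+D≡0 = begin
    + 8 * T + D
      ≡⟨ cong (_+ D) (*-distribˡ-∑ax+by n (+ 8) (λ a b x y → oddPart x * oddPart y)) ⟩
    ∑ax+by≡ n (λ a b x y → + 8 * (oddPart x * oddPart y)) + D
      ≡⟨ ∑ax+by-distrib-+ n (λ a b x y → + 8 * (oddPart x * oddPart y)) (λ a b x y → [ a ≡ b ] * g x y) ⟨
    ∑ax+by≡ n (λ a b x y → + 8 * (oddPart x * oddPart y) + [ a ≡ b ] * g x y)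
      ≡⟨ ∑ax+by-cong n (λ a b x y → cong (_+ [ a ≡ b ] * g x y) (2u≡8oddPart x y)) ⟨
    ∑ax+by≡ n (λ a b x y → + 2 * u x y + [ a ≡ b ] * g x y)
      ≡⟨ liouville-identity n ⟩
    0ℤ ∎
    where
    2u≡8oddPart : ∀ x y → + 2 * u x y ≡ + 8 * (oddPart x * oddPart y)
    2u≡8oddPart x y = trans (cong (+ 2 *_) (u≡4oddPart x y)) (sym (ℤ.*-assoc (+ 2) (+ 4) (oddPart x * oddPart y)))
  -6∑x+y-g : ∀ a m → 0 < m → - + 6 * ∑x+y≡ m g ≡ W m
  -6∑x+y-g _ (suc k) _ = trans (sym (ℤ.neg-distribˡ-* (+ 6) (∑x+y≡ (suc k) g)))
                     (trans (cong -_ (∑x+y-g k)) (ℤ.neg-involutive (W (suc k))))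

𝟙-odd≡parity : ∀ d → 𝟙 (d ℕ.% 2 ℕ.≟ 1) ≡ parity d
𝟙-odd≡parity zero          = refl
𝟙-odd≡parity (suc zero)    = refl
𝟙-odd≡parity (suc (suc d)) = 𝟙-odd≡parity d

sum-applyUpTo : ∀ (f : ℕ → ℕ) k → + sum (applyUpTo f k) ≡ ∑[ i < k ] (+ f i)
sum-applyUpTo f zero    = refl
sum-applyUpTo f (suc k) = trans (ℤ.pos-+ (f 0) _) (cong (_+_ (+ f 0)) (sum-applyUpTo (f ∘ suc) k))

sum-filter-applyUpTo : ∀ {p} {P : ℕ → Set p} (P? : Decidable P) (f : ℕ → ℕ) k →
  + sum (filter P? (applyUpTo f k)) ≡ ∑[ i < k ] (𝟙 (P? (f i)) * + f i)
sum-filter-applyUpTo P? f zero = refl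
sum-filter-applyUpTo P? f (suc k) with P? (f 0)
... | yes _ = trans (ℤ.pos-+ (f 0) _)
                    (cong₂ _+_ (sym (ℤ.*-identityˡ (+ f 0))) (sum-filter-applyUpTo P? (f ∘ suc) k))
... | no _  = trans (sum-filter-applyUpTo P? (f ∘ suc) k) (sym (ℤ.+-identityˡ _))

[∣]≡∑⁺ : ∀ n k d → 0 < k → k ≤ n → 0 < d → 𝟙 (d ∣? k) ≡ ∑[ 0< a ≤ n ] [ a ℕ.* d ≡ k ]
[∣]≡∑⁺ n k d 0<k k≤n 0<d with d ∣? k
... | yes (divides q k≡q*d) = sym (begin
  ∑[ 0< a ≤ n ] [ a ℕ.* d ≡ k ]
    ≡⟨ ∑⁺-cong n (λ a → trans (𝟙-⇔ (a ℕ.* d ℕ.≟ k) (a ℕ.≟ q) ad≡k⇔a≡q) (sym (ℤ.*-identityʳ [ a ≡ q ]))) ⟩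
  ∑[ 0< a ≤ n ] ([ a ≡ q ] * 1ℤ)
    ≡⟨ ∑⁺-pick n q (λ _ → 1ℤ) 0<q q≤n ⟩
  1ℤ ∎)
  where
  open ≡-Reasoning
  instance _ = ℕ.>-nonZero 0<d
  ad≡k⇔a≡q : ∀ {a} → a ℕ.* d ≡ k ⇔ a ≡ q
  ad≡k⇔a≡q {a} = mk⇔ (λ e → ℕ.*-cancelʳ-≡ a q d (trans e k≡q*d))
                      (λ a≡q → trans (cong (ℕ._* d) a≡q) (sym k≡q*d))
  0<q : 0 < q
  0<q = ℕ.n≢0⇒n>0 λ { refl → ℕ.<⇒≢ 0<k (sym k≡q*d) }
  q≤n : q ≤ n
  q≤n = ℕ.≤-trans (ℕ.m≤m*n q d) (ℕ.≤-trans (ℕ.≤-reflexive (sym k≡q*d)) k≤n)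
... | no d∤k = sym (∑-zero n λ a _ → 𝟙-no (suc a ℕ.* d ℕ.≟ k) λ ad≡k → d∤k (divides (suc a) (sym ad≡k)))

σodd≡∑ax≡ : ∀ n k → k ≤ n → + σodd k ≡ ∑[ 0< a ≤ n ] ∑[ 0< x ≤ n ] ([ a ℕ.* x ≡ k ] * oddPart x)
σodd≡∑ax≡ n zero    _   = sym (∑-zero n λ _ _ → ∑-zero n λ _ _ → refl)
σodd≡∑ax≡ n k@(suc _) k≤n = begin
  + sum (filter P? (map suc (upTo k)))
    ≡⟨ cong (λ ds → + sum (filter P? ds)) (map-applyUpTo id suc k) ⟩
  + sum (filter P? (applyUpTo suc k))
    ≡⟨ sum-filter-applyUpTo P? suc k ⟩
  ∑[ 0< d ≤ k ] (𝟙 (P? d) * + d)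
    ≡⟨ ∑⁺-cong k odd-divisor ⟩
  ∑[ 0< d ≤ k ] (𝟙 (d ∣? k) * oddPart d)
    ≡⟨ ∑-truncate k≤n (λ i k≤i → cong (_* oddPart (suc i)) (𝟙-no (suc i ∣? k) (>⇒∤ (s≤s k≤i)))) ⟨
  ∑[ 0< x ≤ n ] (𝟙 (x ∣? k) * oddPart x)
    ≡⟨ ∑⁺-cong-≤ n (λ x 0<x _ → trans (cong (_* oddPart x) ([∣]≡∑⁺ n k x (s≤s z≤n) k≤n 0<x))
                                      (*-distribʳ-∑ n (λ a → [ suc a ℕ.* x ≡ k ]) (oddPart x))) ⟩
  ∑[ 0< x ≤ n ] ∑[ 0< a ≤ n ] ([ a ℕ.* x ≡ k ] * oddPart x)
    ≡⟨ ∑⁺-comm n (λ x a → [ a ℕ.* x ≡ k ] * oddPart x) ⟩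
  ∑[ 0< a ≤ n ] ∑[ 0< x ≤ n ] ([ a ℕ.* x ≡ k ] * oddPart x) ∎
  where
  open ≡-Reasoning
  P? : Decidable (λ d → d ∣ k × d ℕ.% 2 ≡ 1)
  P? d = (d ∣? k) ×-dec (d ℕ.% 2 ℕ.≟ 1)
  odd-divisor : ∀ d → 𝟙 (P? d) * + d ≡ 𝟙 (d ∣? k) * oddPart d
  odd-divisor d = begin
    𝟙 (P? d) * + d                       ≡⟨ cong (_* + d) (𝟙-× (d ∣? k) (d ℕ.% 2 ℕ.≟ 1)) ⟩
    𝟙 (d ∣? k) * 𝟙 (d ℕ.% 2 ℕ.≟ 1) * + d ≡⟨ ℤ.*-assoc (𝟙 (d ∣? k)) (𝟙 (d ℕ.% 2 ℕ.≟ 1)) (+ d) ⟩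
    𝟙 (d ∣? k) * (𝟙 (d ℕ.% 2 ℕ.≟ 1) * + d) ≡⟨ cong (λ p → 𝟙 (d ∣? k) * (p * + d)) (𝟙-odd≡parity d) ⟩
    𝟙 (d ∣? k) * oddPart d               ∎

convolution-collapse : ∀ n p q (z : ℤ) → ∑[ k < suc n ] ([ p ≡ k ] * ([ q ≡ n ℕ.∸ k ] * z)) ≡ [ p ℕ.+ q ≡ n ] * z
convolution-collapse n p q z = begin
  ∑[ k < suc n ] ([ p ≡ k ] * ([ q ≡ n ℕ.∸ k ] * z))  ≡⟨ ∑-cong′ (suc n) (λ k → cong (_* ([ q ≡ n ℕ.∸ k ] * z)) ([≡]-sym p k)) ⟩
  ∑[ k < suc n ] ([ k ≡ p ] * ([ q ≡ n ℕ.∸ k ] * z))  ≡⟨ ∑-indicator (suc n) p (λ k → [ q ≡ n ℕ.∸ k ] * z) ⟩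
  [ p < suc n ] * ([ q ≡ n ℕ.∸ p ] * z)               ≡⟨ cases (p ℕ.≤? n) ⟩
  [ p ℕ.+ q ≡ n ] * z                                 ∎
  where
  open ≡-Reasoning
  cases : Dec (p ≤ n) → [ p < suc n ] * ([ q ≡ n ℕ.∸ p ] * z) ≡ [ p ℕ.+ q ≡ n ] * z
  cases (yes p≤n) = trans (cong (_* ([ q ≡ n ℕ.∸ p ] * z)) ([<]-yes (s≤s p≤n)))
    (trans (ℤ.*-identityˡ _) (cong (_* z) (𝟙-⇔ (q ℕ.≟ n ℕ.∸ p) (p ℕ.+ q ℕ.≟ n)
      (mk⇔ (λ e → trans (cong (p ℕ.+_) e) (ℕ.m+[n∸m]≡n p≤n)) (λ e → trans (sym (ℕ.m+n∸m≡n p q)) (cong (ℕ._∸ p) e))))))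
  cases (no p≰n) = trans (cong (_* ([ q ≡ n ℕ.∸ p ] * z)) ([<]-no (p≰n ∘ ℕ.≤-pred)))
    (sym (cong (_* z) ([≡]-vanishes (ℕ.<-≤-trans (ℕ.≰⇒> p≰n) (ℕ.m≤m+n p q)))))

∑-convolution : ∀ n (F G : ℕ → ℕ → ℤ) →
  ∑[ k < suc n ] ((∑[ 0< a ≤ n ] ∑[ 0< x ≤ n ] ([ a ℕ.* x ≡ k ] * F a x))
                 * (∑[ 0< b ≤ n ] ∑[ 0< y ≤ n ] ([ b ℕ.* y ≡ n ℕ.∸ k ] * G b y)))
  ≡ ∑ax+by≡ n (λ a b x y → F a x * G b y)
∑-convolution n F G = begin
  ∑[ k < suc n ] (∑⁺ n (A k) * ∑⁺ n (B k))
    ≡⟨ ∑-cong′ (suc n) (λ k → trans (∑-*-∑ n n (A k ∘ suc) (B k ∘ suc))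
                                      (∑⁺-cong n λ a → ∑⁺-cong n λ b → ∑-*-∑ n n (α k a ∘ suc) (β k b ∘ suc))) ⟩
  ∑[ k < suc n ] ∑⁴ n (λ a b x y → α k a x * β k b y)
    ≡⟨ ∑-∑⁴-comm (suc n) n (λ k a b x y → α k a x * β k b y) ⟩
  ∑⁴ n (λ a b x y → ∑[ k < suc n ] (α k a x * β k b y))
    ≡⟨ ∑⁴-cong n (λ a b x y → trans (∑-cong′ (suc n) λ k → regroup k a b x y)
                                    (convolution-collapse n (a ℕ.* x) (b ℕ.* y) (F a x * G b y))) ⟩
  ∑ax+by≡ n (λ a b x y → F a x * G b y) ∎
  where
  open ≡-Reasoning
  α β : ℕ → ℕ → ℕ → ℤ
  α k a x = [ a ℕ.* x ≡ k ] * F a x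
  β k b y = [ b ℕ.* y ≡ n ℕ.∸ k ] * G b y
  A B : ℕ → ℕ → ℤ
  A k a = ∑⁺ n (α k a)
  B k b = ∑⁺ n (β k b)
  regroup : ∀ k a b x y → α k a x * β k b y ≡ [ a ℕ.* x ≡ k ] * ([ b ℕ.* y ≡ n ℕ.∸ k ] * (F a x * G b y))
  regroup k a b x y = interleave [ a ℕ.* x ≡ k ] (F a x) [ b ℕ.* y ≡ n ℕ.∸ k ] (G b y)
    where
    interleave : ∀ P F Q G → P * F * (Q * G) ≡ P * (Q * (F * G))
    interleave = solve-∀

σodd*2≡∑ax+by : ∀ n → + σodd*2 n ≡ ∑ax+by≡ n (λ a b x y → oddPart x * oddPart y)
σodd*2≡∑ax+by n = begin
  + sum (map product (upTo (suc n)))      ≡⟨ cong (+_ ∘ sum) (map-applyUpTo id product (suc n)) ⟩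
  + sum (applyUpTo product (suc n))       ≡⟨ sum-applyUpTo product (suc n) ⟩
  ∑[ k < suc n ] (+ product k)            ≡⟨ ∑-cong (suc n) (λ k k≤n → trans (ℤ.pos-* (σodd k) (σodd (n ℕ.∸ k)))
                                                (cong₂ _*_ (σodd≡∑ax≡ n k (ℕ.≤-pred k≤n)) (σodd≡∑ax≡ n (n ℕ.∸ k) (ℕ.m∸n≤m n k)))) ⟩
  ∑[ k < suc n ] ((∑[ 0< a ≤ n ] ∑[ 0< x ≤ n ] ([ a ℕ.* x ≡ k ] * oddPart x))
                 * (∑[ 0< b ≤ n ] ∑[ 0< y ≤ n ] ([ b ℕ.* y ≡ n ℕ.∸ k ] * oddPart y)))
                                          ≡⟨ ∑-convolution n (λ _ x → oddPart x) (λ _ y → oddPart y) ⟩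
  ∑ax+by≡ n (λ a b x y → oddPart x * oddPart y) ∎
  where
  open ≡-Reasoning
  product : ℕ → ℕ
  product k = σodd k ℕ.* σodd (n ℕ.∸ k)

∣-combination : ∀ {d X Y} P Q → d ∣ℤ X → d ∣ℤ Y → d ∣ℤ P * X + Q * Y
∣-combination P Q d∣X d∣Y = ℤᵈ.∣m∣n⇒∣m+n (ℤᵈ.∣n⇒∣m*n P d∣X) (ℤᵈ.∣n⇒∣m*n Q d∣Y)

t³-t : ℤ → ℤ
t³-t t = t * t * t - t
{-# INLINE t³-t #-}

t³+2t : ℤ → ℤ
t³+2t t = t * t * t + + 2 * t
{-# INLINE t³+2t #-}

t⁵-t : ℤ → ℤ
t⁵-t t = t * t * t * t * t - t
{-# INLINE t⁵-t #-}

fermat₅ : ∀ x → + 5 ∣ℤ t⁵-t (+ x)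
fermat₅ zero    = ℤᵈ.divides 0ℤ refl
fermat₅ (suc x) = subst (λ X → + 5 ∣ℤ t⁵-t X) (sym (ℤ.pos-+ 1 x))
  (subst (+ 5 ∣ℤ_) (sym (binomial (+ x))) (ℤᵈ.∣m∣n⇒∣m+n (fermat₅ x) (ℤᵈ.divides (middle (+ x)) refl)))
  where
  middle : ℤ → ℤ
  middle X = X * X * X * X + + 2 * (X * X * X) + + 2 * (X * X) + X
  {-# INLINE middle #-}
  binomial : ∀ X → t⁵-t (1ℤ + X) ≡ t⁵-t X + middle X * + 5
  binomial = solve-∀

-- By Fermat A⁴ ≡ 1, so the inverse C of A is A³.
inverse-is-cube : ∀ A C → + 5 ∣ℤ A * C - 1ℤ → + 5 ∣ℤ t⁵-t A → + 5 ∣ℤ C - A * A * A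
inverse-is-cube A C 5∣AC-1 5∣A⁵-A =
  subst (+ 5 ∣ℤ_) (sym (certificate A C))
        (∣-combination (C * (A * A * A * A) - C + A * A * A) (- (C * C)) 5∣AC-1 5∣A⁵-A)
  where
  certificate : ∀ A C → C - A * A * A ≡
    (C * (A * A * A * A) - C + A * A * A) * (A * C - 1ℤ) + - (C * C) * t⁵-t A
  certificate = solve-∀

unit-mod-5 : ∀ a m k → a ℕ.* m ≡ 5 ℕ.* k ℕ.+ 1 → + 5 ∣ℤ + a * + m - 1ℤ
unit-mod-5 a m k am≡5k+1 = ℤᵈ.divides (+ k) (begin
  + a * + m - 1ℤ              ≡⟨ cong (_- 1ℤ) (ℤ.pos-* a m) ⟨
  + (a ℕ.* m) - 1ℤ            ≡⟨ cong (λ t → + t - 1ℤ) am≡5k+1 ⟩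
  + (5 ℕ.* k ℕ.+ 1) - 1ℤ      ≡⟨ cong (_- 1ℤ) (trans (ℤ.pos-+ (5 ℕ.* k) 1) (cong (_+ 1ℤ) (ℤ.pos-* 5 k))) ⟩
  + 5 * + k + 1ℤ - 1ℤ         ≡⟨ cancel (+ k) ⟩
  + k * + 5                   ∎)
  where
  open ≡-Reasoning
  cancel : ∀ K → + 5 * K + 1ℤ - 1ℤ ≡ K * + 5
  cancel = solve-∀

cubic-pair : ∀ a m k → a ℕ.* m ≡ 5 ℕ.* k ℕ.+ 1 → + 5 ∣ℤ t³-t (+ m) + t³-t (+ a)
cubic-pair a m k am≡5k+1 =
  subst (+ 5 ∣ℤ_) (sym (certificate (+ a) (+ m)))
        (∣-combination (C * C + C * A³ + A³ * A³ - 1ℤ) (A * A³ + 1ℤ) (inverse-is-cube A C 5∣AC-1 (fermat₅ a)) (fermat₅ a))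
  where
  A C A³ : ℤ
  A = + a
  C = + m
  A³ = A * A * A
  5∣AC-1 : + 5 ∣ℤ A * C - 1ℤ
  5∣AC-1 = unit-mod-5 a m k am≡5k+1
  certificate : ∀ A C → t³-t C + t³-t A ≡
    (C * C + C * (A * A * A) + A * A * A * (A * A * A) - 1ℤ) * (C - A * A * A) + (A * (A * A * A) + 1ℤ) * t⁵-t A
  certificate = solve-∀

even-pair : ∀ a j k → a ℕ.* (j ℕ.+ j) ≡ 5 ℕ.* k ℕ.+ 1 → + 5 ∣ℤ t³+2t (+ (j ℕ.+ j)) + t³+2t (+ (a ℕ.+ a))
even-pair a j k a2j≡5k+1 =
  subst (+ 5 ∣ℤ_) (sym (trans (cong (λ t → t³+2t C + t³+2t t) (ℤ.pos-+ a a)) (certificate A C)))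
        (ℤᵈ.∣m∣n⇒∣m+n (∣-combination (C * C + C * A³ + A³ * A³ + + 2) (A * A³ + 1ℤ) (inverse-is-cube A C 5∣AC-1 (fermat₅ a)) (fermat₅ a))
                      (ℤᵈ.divides (+ 2 * A³ + A) refl))
  where
  A C A³ : ℤ
  A = + a
  C = + (j ℕ.+ j)
  A³ = A * A * A
  5∣AC-1 : + 5 ∣ℤ A * C - 1ℤ
  5∣AC-1 = unit-mod-5 a (j ℕ.+ j) k a2j≡5k+1
  certificate : ∀ A C → t³+2t C + t³+2t (A + A) ≡
    (C * C + C * (A * A * A) + A * A * A * (A * A * A) + + 2) * (C - A * A * A) + (A * (A * A * A) + 1ℤ) * t⁵-t A
      + (+ 2 * (A * A * A) + A) * + 5
  certificate = solve-∀

∣-cancel-coprime : ∀ d c {X} → Coprime d c → d ∣ℤ c * X → d ∣ℤ X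
∣-cancel-coprime d c {X} d⊥c d∣cX = ℤᵈ.∣ᵤ⇒∣ (coprime-divisor d c X d⊥c (ℤᵈ.∣⇒∣ᵤ d∣cX))

W-decomposition : ∀ m → W m ≡ + 4 * t³-t (+ m) + + 2 * ((1ℤ - parity m) * t³+2t (+ m))
W-decomposition m = trans (cong (Polynomial.W (+ m)) (sgn≡1-2parity m)) (by-parity (+ m) (parity m))
  where
  by-parity : ∀ M p → Polynomial.W M (1ℤ - + 2 * p) ≡ + 4 * t³-t M + + 2 * ((1ℤ - p) * t³+2t M)
  by-parity = solve-∀

5∣∑am-W : ∀ k → + 5 ∣ℤ ∑am≡ (5 ℕ.* k ℕ.+ 1) (λ a m → W m)
5∣∑am-W k = subst (+ 5 ∣ℤ_) (sym decomposition) (∣-combination (+ 4) (+ 2) odd-part even-part)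
  where
  n : ℕ
  n = 5 ℕ.* k ℕ.+ 1
  odd even : ℕ → ℕ → ℤ
  odd a m = t³-t (+ m)
  even a m = (1ℤ - parity m) * t³+2t (+ m)
  decomposition : ∑am≡ n (λ a m → W m) ≡ + 4 * ∑am≡ n odd + + 2 * ∑am≡ n even
  decomposition = begin
    ∑am≡ n (λ a m → W m)                                   ≡⟨ ∑pairs-cong ℕ._*_ n (λ a m _ → W-decomposition m) ⟩
    ∑am≡ n (λ a m → + 4 * odd a m + + 2 * even a m)
      ≡⟨ ∑pairs-distrib-+ ℕ._*_ n (λ a m → + 4 * odd a m) (λ a m → + 2 * even a m) ⟩
    ∑am≡ n (λ a m → + 4 * odd a m) + ∑am≡ n (λ a m → + 2 * even a m)
      ≡⟨ cong₂ _+_ (*-distribˡ-∑pairs ℕ._*_ n (+ 4) odd) (*-distribˡ-∑pairs ℕ._*_ n (+ 2) even) ⟨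
    + 4 * ∑am≡ n odd + + 2 * ∑am≡ n even                   ∎
    where open ≡-Reasoning
  5⊥2 : Coprime (+ 5) (+ 2)
  5⊥2 = from-yes (coprime? (+ 5) (+ 2))
  odd-part : + 5 ∣ℤ ∑am≡ n odd
  odd-part = ∣-cancel-coprime (+ 5) (+ 2) 5⊥2 (subst (+ 5 ∣ℤ_) (sym (∑pairs-symmetrize ℕ._*_ n odd ℕ.*-comm))
                              (∑pairs-∣ ℕ._*_ n _ λ a m am≡n → cubic-pair a m k am≡n))
  a2j : ℕ → ℕ → ℕ
  a2j a j = a ℕ.* (j ℕ.+ j)
  a2j-comm : ∀ a j → a ℕ.* (j ℕ.+ j) ≡ j ℕ.* (a ℕ.+ a)
  a2j-comm = ℕ-Solver.solve-∀
  even-part : + 5 ∣ℤ ∑am≡ n even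
  even-part = subst (+ 5 ∣ℤ_) (sym (∑am-even n (t³+2t ∘ +_)))
    (∣-cancel-coprime (+ 5) (+ 2) 5⊥2 (subst (+ 5 ∣ℤ_) (sym (∑pairs-symmetrize a2j n (λ a j → t³+2t (+ (j ℕ.+ j))) a2j-comm))
                               (∑pairs-∣ a2j n _ λ a j a2j≡n → even-pair a j k a2j≡n)))

proposition5p2 : (n : ℕ) → 5 ∣ σodd*2 (5 ℕ.* n ℕ.+ 1)
proposition5p2 k = ℤᵈ.∣⇒∣ᵤ (∣-cancel-coprime (+ 5) (+ 48) (from-yes (coprime? (+ 5) (+ 48))) 5∣48σ)
  where
  n : ℕ
  n = 5 ℕ.* k ℕ.+ 1
  48σ≡∑W : + 48 * + σodd*2 n ≡ ∑am≡ n (λ a m → W m)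
  48σ≡∑W = trans (cong (+ 48 *_) (σodd*2≡∑ax+by n)) (48∑ax+by-oddPart≡∑am-W n)
  5∣48σ : + 5 ∣ℤ + 48 * + σodd*2 n
  5∣48σ = subst (+ 5 ∣ℤ_) (sym 48σ≡∑W) (5∣∑am-W k)
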